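{- For every integer $d\geq 3$, the $d$-dimensional hypercube $Q_d$ satisfies $\chi'_s(Q_d)\leq 2d-2$. Moreover, this bound is tight (it is attained for some $d\geq 3$).
   Context: $Q_d$ is the Cartesian product of $d$ copies of $P_2$ (the path with two vertices). A star edge coloring of a graph is a proper edge coloring such that no path or cycle with four edges uses at most two colors; $\chi'_s(G)$ is the minimum number of colors in a star edge coloring of $G$. The Cartesian product $G\square H$ has vertex set $V(G)\times V(H)$, with $(a,x)(b,y)$ an edge iff either $ab\in E(G)$ and $x=y$, or $xy\in E(H)$ and $a=b$. -}

module Defs where

open import Data.Nat using (ℕ; zero; suc)
open import Data.Fin using (Fin)
open import Data.Bool using (Bool)
open import Data.Unit using (⊤)
open import Data.Empty using (⊥)
open import Data.Product using (_×_; Σ; ∃; _,_)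
open import Data.Sum using (_⊎_)
open import Relation.Nullary using (¬_)
open import Relation.Binary.PropositionalEquality using (_≡_; _≢_)

record Graph : Set₁ where
  field
    V   : Set
    Adj : V → V → Set
open Graph public

P₂ : Graph
P₂ = record { V = Bool ; Adj = λ x y → x ≢ y }

K₁ : Graph
K₁ = record { V = ⊤ ; Adj = λ _ _ → ⊥ }

_□_ : Graph → Graph → Graph
G □ H = record
  { V   = V G × V H
  ; Adj = λ { (a , x) (b , y) → (Adj G a b × x ≡ y) ⊎ (Adj H x y × a ≡ b) } }

Q : ℕ → Graph
Q zero    = K₁
Q (suc d) = Q d □ P₂

-- An edge colouring with colours Fin k: a colour for every edge uv,
-- independent of orientation (and of the adjacency witness).
record EdgeColouring (G : Graph) (k : ℕ) : Set where
  field
    col : (u v : V G) → Adj G u v → Fin k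
    sym : ∀ u v (p : Adj G u v) (q : Adj G v u) → col u v p ≡ col v u q
open EdgeColouring public

Proper : {G : Graph} {k : ℕ} → EdgeColouring G k → Set
Proper {G} c = ∀ u v w (p : Adj G u v) (q : Adj G u w) →
  v ≢ w → col c u v p ≢ col c u w q

-- A path (all five vertices distinct) or a cycle (v₀ = v₄, otherwise
-- distinct) with four edges v₀v₁, v₁v₂, v₂v₃, v₃v₄ using at most two colours.
BichromaticP4orC4 : {G : Graph} {k : ℕ} → EdgeColouring G k → Set
BichromaticP4orC4 {G} c =
  Σ (V G) λ v₀ → Σ (V G) λ v₁ → Σ (V G) λ v₂ → Σ (V G) λ v₃ → Σ (V G) λ v₄ →
  Σ (Adj G v₀ v₁) λ e₁ → Σ (Adj G v₁ v₂) λ e₂ →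
  Σ (Adj G v₂ v₃) λ e₃ → Σ (Adj G v₃ v₄) λ e₄ →
    v₀ ≢ v₁ × v₀ ≢ v₂ × v₀ ≢ v₃ ×
    v₁ ≢ v₂ × v₁ ≢ v₃ × v₁ ≢ v₄ ×
    v₂ ≢ v₃ × v₂ ≢ v₄ × v₃ ≢ v₄ ×
    Σ (Fin _) λ a → Σ (Fin _) λ b →
      (col c v₀ v₁ e₁ ≡ a ⊎ col c v₀ v₁ e₁ ≡ b) ×
      (col c v₁ v₂ e₂ ≡ a ⊎ col c v₁ v₂ e₂ ≡ b) ×
      (col c v₂ v₃ e₃ ≡ a ⊎ col c v₂ v₃ e₃ ≡ b) ×
      (col c v₃ v₄ e₄ ≡ a ⊎ col c v₃ v₄ e₄ ≡ b)

IsStarEdgeColouring : {G : Graph} {k : ℕ} → EdgeColouring G k → Set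
IsStarEdgeColouring c = Proper c × ¬ BichromaticP4orC4 c

-- G has a star edge colouring with (at most) k colours, i.e. χ'_s(G) ≤ k.
StarColourable : Graph → ℕ → Set
StarColourable G k = Σ (EdgeColouring G k) IsStarEdgeColouring

module Submission where

-- Star colourings are handled through alternating walks: in a proper edge
-- colouring of a graph with symmetric adjacency, a two-coloured path or
-- cycle with four edges is the same as a walk v₀v₁v₂v₃v₄ that never turns
-- back (vᵢ ≠ vᵢ₊₂) and whose colours alternate; in a bipartite graph every
-- such walk is conversely a path or a 4-cycle.
--
--  * (prism lemma) if G is bipartite with symmetric adjacency, a star k-edge-colouring of G yields a
--    star (k+2)-edge-colouring of G □ P₂: keep the colours on both copies of
--    G and colour the rungs with two new colours according to the side of
--    the bipartition; every alternating walk in G □ P₂ projects to one in G;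
--  * Q₃ has an explicit star 4-edge-colouring, checked by a decision procedure;
--  * induction from Q₃ with the prism lemma gives χ'_s(Q_d) ≤ 2d − 2;
--  * when 2 ≤ d and k ≤ d, a proper k-edge-colouring of Q_d shows every colour at
--    every vertex, so an alternating walk can always be continued, and
--    Q_d has no star k-edge-colouring; for d = 3 this shows tightness.

open import Defs
open import Data.Nat using (ℕ; zero; suc; _≤_; _<_; _*_; _∸_; _+_; s≤s; z≤n)
open import Data.Nat.Properties using (≤-pred; <⇒≱; *-suc; *-distribˡ-+)
open import Data.Product using (_×_; ∃; Σ; _,_; proj₁; proj₂)
open import Data.Sum using (_⊎_; inj₁; inj₂)
open import Data.Bool using (Bool; true; false; not; _xor_)
open import Data.Bool.Properties
  using (not-involutive; not-¬; ¬-not; xor-assoc; xor-same; xor-identityʳ; xor-comm)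
open import Data.Fin using (Fin; zero; suc; _≟_; punchOut; #_)
open import Data.Fin.Properties using (all?; any?; punchOut-injective; injective⇒≤)
open import Data.Unit using (tt)
open import Data.Empty using (⊥; ⊥-elim)
open import Function.Definitions using (Injective)
open import Relation.Nullary using (¬_; Dec; yes; no; contradiction)
open import Relation.Nullary.Decidable using (map′; from-yes; ¬?; _×-dec_; _→-dec_)
open import Relation.Binary.PropositionalEquality as ≡
  using (_≡_; _≢_; refl; cong; trans; subst; ≢-sym; module ≡-Reasoning)

-- A Graph need not have symmetric adjacency; the hypercubes do, and
-- symmetry is what lets an edge be traversed in both directions.
Symmetric : Graph → Set
Symmetric G = ∀ {u v} → Adj G u v → Adj G v u

record Bipartite (G : Graph) : Set where
  field
    side    : V G → Bool
    crosses : ∀ {u v} → Adj G u v → side u ≢ side v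

□-symmetric : ∀ {G H} → Symmetric G → Symmetric H → Symmetric (G □ H)
□-symmetric symG symH {_ , _} {_ , _} (inj₁ (p , x≡y)) = inj₁ (symG p , ≡.sym x≡y)
□-symmetric symG symH {_ , _} {_ , _} (inj₂ (q , a≡b)) = inj₂ (symH q , ≡.sym a≡b)

xor-cancelʳ : ∀ s {p q} → p xor s ≡ q xor s → p ≡ q
xor-cancelʳ s {p} {q} eq = begin
  p                ≡⟨ ≡.sym (undo p) ⟩
  (p xor s) xor s  ≡⟨ cong (_xor s) eq ⟩
  (q xor s) xor s  ≡⟨ undo q ⟩
  q                ∎
  where
  open ≡-Reasoning
  undo : ∀ r → (r xor s) xor s ≡ r
  undo r = begin
    (r xor s) xor s  ≡⟨ xor-assoc r s s ⟩
    r xor (s xor s)  ≡⟨ cong (r xor_) (xor-same s) ⟩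
    r xor false      ≡⟨ xor-identityʳ r ⟩
    r                ∎

xor-cancelˡ : ∀ s {p q} → s xor p ≡ s xor q → p ≡ q
xor-cancelˡ s {p} {q} eq = xor-cancelʳ s (trans (xor-comm p s) (trans eq (xor-comm s q)))

□-bipartite : ∀ {G H} → Bipartite G → Bipartite H → Bipartite (G □ H)
□-bipartite {G} {H} bipG bipH = record { side = side ; crosses = crosses }
  where
  module BG = Bipartite bipG
  module BH = Bipartite bipH
  side : V (G □ H) → Bool
  side (a , x) = BG.side a xor BH.side x
  crosses : ∀ {u v} → Adj (G □ H) u v → side u ≢ side v
  crosses {a , x} {b , _} (inj₁ (p , refl)) eq = BG.crosses p (xor-cancelʳ (BH.side x) eq)
  crosses {a , _} {_ , _} (inj₂ (q , refl)) eq = BH.crosses q (xor-cancelˡ (BG.side a) eq)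

Q-symmetric : ∀ d → Symmetric (Q d)
Q-symmetric zero    ()
Q-symmetric (suc d) = □-symmetric (Q-symmetric d) ≢-sym

Q-bipartite : ∀ d → Bipartite (Q d)
Q-bipartite zero    = record { side = λ _ → false ; crosses = λ () }
Q-bipartite (suc d) = □-bipartite (Q-bipartite d) (record { side = λ x → x ; crosses = λ x≢y → x≢y })

module _ {G : Graph} (symmetric : Symmetric G) {k : ℕ} (c : EdgeColouring G k) where

  colour-irrelevant : ∀ {u v} (p q : Adj G u v) → col c u v p ≡ col c u v q
  colour-irrelevant p q = trans (sym c _ _ p (symmetric p)) (sym c _ _ (symmetric p) q)

  different-colours⇒different-ends : ∀ {u v w} (p : Adj G u v) (q : Adj G u w) →
    col c u v p ≢ col c u w q → v ≢ w
  different-colours⇒different-ends p q p≢q refl = p≢q (colour-irrelevant p q)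

  consecutive-colours-differ : Proper c → ∀ {v₀ v₁ v₂}
    (e₁ : Adj G v₀ v₁) (e₂ : Adj G v₁ v₂) → v₀ ≢ v₂ → col c v₀ v₁ e₁ ≢ col c v₁ v₂ e₂
  consecutive-colours-differ proper e₁ e₂ v₀≢v₂ eq =
    proper _ _ _ (symmetric e₁) e₂ v₀≢v₂ (trans (sym c _ _ (symmetric e₁) e₁) eq)

-- Alternating walks

record AlternatingWalk {G : Graph} {k : ℕ} (c : EdgeColouring G k) : Set where
  constructor alternating
  field
    v₀ v₁ v₂ v₃ v₄ : V G
    e₁ : Adj G v₀ v₁
    e₂ : Adj G v₁ v₂
    e₃ : Adj G v₂ v₃
    e₄ : Adj G v₃ v₄
    turn₁ : v₀ ≢ v₂
    turn₂ : v₁ ≢ v₃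
    turn₃ : v₂ ≢ v₄
    repeat₁ : col c v₀ v₁ e₁ ≡ col c v₂ v₃ e₃
    repeat₂ : col c v₁ v₂ e₂ ≡ col c v₃ v₄ e₄

two-values-alternate : ∀ {A : Set} {x y z a b : A} → x ≢ y → y ≢ z →
  (x ≡ a ⊎ x ≡ b) → (y ≡ a ⊎ y ≡ b) → (z ≡ a ⊎ z ≡ b) → x ≡ z
two-values-alternate x≢y _   (inj₁ x≡a) (inj₁ y≡a) _          = contradiction (trans x≡a (≡.sym y≡a)) x≢y
two-values-alternate _   _   (inj₁ x≡a) (inj₂ _)   (inj₁ z≡a) = trans x≡a (≡.sym z≡a)
two-values-alternate _   y≢z (inj₁ _)   (inj₂ y≡b) (inj₂ z≡b) = contradiction (trans y≡b (≡.sym z≡b)) y≢z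
two-values-alternate _   y≢z (inj₂ _)   (inj₁ y≡a) (inj₁ z≡a) = contradiction (trans y≡a (≡.sym z≡a)) y≢z
two-values-alternate _   _   (inj₂ x≡b) (inj₁ _)   (inj₂ z≡b) = trans x≡b (≡.sym z≡b)
two-values-alternate x≢y _   (inj₂ x≡b) (inj₂ y≡b) _          = contradiction (trans x≡b (≡.sym y≡b)) x≢y

bichromatic⇒alternating : ∀ {G : Graph} {k} → Symmetric G → (c : EdgeColouring G k) → Proper c →
  BichromaticP4orC4 c → AlternatingWalk c
bichromatic⇒alternating {G} symmetric c proper
  (v₀ , v₁ , v₂ , v₃ , v₄ , e₁ , e₂ , e₃ , e₄ , _ , v₀≢v₂ , _ , _ , v₁≢v₃ , _ , _ , v₂≢v₄ , _ ,
   _ , _ , c₁ , c₂ , c₃ , c₄) =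
  alternating v₀ v₁ v₂ v₃ v₄ e₁ e₂ e₃ e₄ v₀≢v₂ v₁≢v₃ v₂≢v₄
    (two-values-alternate (differ e₁ e₂ v₀≢v₂) (differ e₂ e₃ v₁≢v₃) c₁ c₂ c₃)
    (two-values-alternate (differ e₂ e₃ v₁≢v₃) (differ e₃ e₄ v₂≢v₄) c₂ c₃ c₄)
  where
  differ : ∀ {u v w} (p : Adj G u v) (q : Adj G v w) → u ≢ w → col c u v p ≢ col c v w q
  differ = consecutive-colours-differ symmetric c proper

module _ {G : Graph} (bipartite : Bipartite G) where
  open Bipartite bipartite

  adjacent⇒distinct : ∀ {u v} → Adj G u v → u ≢ v
  adjacent⇒distinct p refl = crosses p refl

  -- Walks of odd length change sides, so their ends differ.
  odd-walk⇒distinct : ∀ {u₁ u₂ u₃ u₄} →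
    Adj G u₁ u₂ → Adj G u₂ u₃ → Adj G u₃ u₄ → u₁ ≢ u₄
  odd-walk⇒distinct p q r refl =
    crosses r (trans (¬-not (≢-sym (crosses q))) (≡.sym (¬-not (crosses p))))

  alternating⇒bichromatic : ∀ {k} {c : EdgeColouring G k} → AlternatingWalk c → BichromaticP4orC4 c
  alternating⇒bichromatic {c = c} (alternating v₀ v₁ v₂ v₃ v₄ e₁ e₂ e₃ e₄ t₁ t₂ t₃ r₁ r₂) =
    v₀ , v₁ , v₂ , v₃ , v₄ , e₁ , e₂ , e₃ , e₄ ,
    adjacent⇒distinct e₁ , t₁ , odd-walk⇒distinct e₁ e₂ e₃ ,
    adjacent⇒distinct e₂ , t₂ , odd-walk⇒distinct e₂ e₃ e₄ ,
    adjacent⇒distinct e₃ , t₃ , adjacent⇒distinct e₄ ,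
    col c v₀ v₁ e₁ , col c v₁ v₂ e₂ , inj₁ refl , inj₂ refl , inj₁ (≡.sym r₁) , inj₂ (≡.sym r₂)

star-if-no-alternating-walk : ∀ {G k} → Symmetric G → {c : EdgeColouring G k} →
  Proper c → ¬ AlternatingWalk c → IsStarEdgeColouring c
star-if-no-alternating-walk symmetric proper no-walk =
  proper , λ bichromatic → no-walk (bichromatic⇒alternating symmetric _ proper bichromatic)

star-has-no-alternating-walk : ∀ {G k} → Bipartite G → {c : EdgeColouring G k} →
  IsStarEdgeColouring c → ¬ AlternatingWalk c
star-has-no-alternating-walk bipartite (_ , no-bichromatic) walk =
  no-bichromatic (alternating⇒bichromatic bipartite walk)

-- The prism lemma: χ'_s(G □ P₂) ≤ χ'_s(G) + 2 for symmetric bipartite G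

module Prism {G : Graph} (bipartite : Bipartite G) {k : ℕ} (c : EdgeColouring G k) where
  open Bipartite bipartite

  rung-colour : Bool → Fin (2 + k)
  rung-colour true  = zero
  rung-colour false = suc zero

  prism-col : (u v : V (G □ P₂)) → Adj (G □ P₂) u v → Fin (2 + k)
  prism-col (a , _) (b , _) (inj₁ (p , _)) = suc (suc (col c a b p))
  prism-col (a , _) _       (inj₂ _)       = rung-colour (side a)

  prism-col-sym : ∀ u v p q → prism-col u v p ≡ prism-col v u q
  prism-col-sym (a , _) (b , _) (inj₁ (p , _))   (inj₁ (q , _))   = cong (λ γ → suc (suc γ)) (sym c a b p q)
  prism-col-sym _       _       (inj₁ (_ , x≡y)) (inj₂ (y≢x , _)) = contradiction (≡.sym x≡y) y≢x
  prism-col-sym _       _       (inj₂ (x≢y , _)) (inj₁ (_ , y≡x)) = contradiction (≡.sym y≡x) x≢y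
  prism-col-sym _       _       (inj₂ (_ , refl)) (inj₂ _)        = refl

  prism-colouring : EdgeColouring (G □ P₂) (2 + k)
  prism-colouring = record { col = prism-col ; sym = prism-col-sym }

  old≢rung : ∀ γ s → _≢_ {A = Fin (2 + k)} (suc (suc γ)) (rung-colour s)
  old≢rung γ true  ()
  old≢rung γ false ()

  shift-injective : ∀ {γ δ : Fin k} → _≡_ {A = Fin (2 + k)} (suc (suc γ)) (suc (suc δ)) → γ ≡ δ
  shift-injective refl = refl

  rungs-over-edge-differ : ∀ {a b} → Adj G a b → rung-colour (side a) ≢ rung-colour (side b)
  rungs-over-edge-differ p eq = crosses p (rung-colour-injective eq)
    where
    rung-colour-injective : ∀ {s t} → rung-colour s ≡ rung-colour t → s ≡ t
    rung-colour-injective {true}  {true}  _ = refl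
    rung-colour-injective {false} {false} _ = refl

  two-rungs-return : ∀ {a : V G} {x y z : Bool} → x ≢ y → y ≢ z → _≡_ {A = V (G □ P₂)} (a , x) (a , z)
  two-rungs-return {a} x≢y y≢z = cong (a ,_) (trans (¬-not x≢y) (≡.sym (¬-not (≢-sym y≢z))))

  -- Each copy of G is coloured properly by c, copy edges never share a
  -- colour with rungs, and a vertex has only one rung.
  prism-proper : Proper c → Proper prism-colouring
  prism-proper proper (a , x) (b , _) (b′ , _) (inj₁ (p , refl)) (inj₁ (q , refl)) ends-differ eq =
    proper a b b′ p q (λ b≡b′ → ends-differ (cong (_, x) b≡b′)) (shift-injective eq)
  prism-proper proper _ _ _ (inj₁ _) (inj₂ _) _ eq = old≢rung _ _ eq
  prism-proper proper _ _ _ (inj₂ _) (inj₁ _) _ eq = old≢rung _ _ (≡.sym eq)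
  prism-proper proper _ _ _ (inj₂ (x≢y , refl)) (inj₂ (x≢y′ , refl)) ends-differ _ =
    ends-differ (two-rungs-return (≢-sym x≢y) x≢y′)

  -- Every alternating walk in the prism runs inside one copy of G, so it is
  -- an alternating walk of G.  Edges are either copies of G-edges (inj₁) or
  -- rungs (inj₂); equal colours force equal kinds.
  project : AlternatingWalk prism-colouring → AlternatingWalk c
  project (alternating (a₀ , x) (a₁ , _) (a₂ , _) (a₃ , _) (a₄ , _)
           (inj₁ (p₁ , refl)) (inj₁ (p₂ , refl)) (inj₁ (p₃ , refl)) (inj₁ (p₄ , refl)) t₁ t₂ t₃ r₁ r₂) =
    alternating a₀ a₁ a₂ a₃ a₄ p₁ p₂ p₃ p₄
      (λ eq → t₁ (cong (_, x) eq)) (λ eq → t₂ (cong (_, x) eq)) (λ eq → t₃ (cong (_, x) eq))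
      (shift-injective r₁) (shift-injective r₂)
  project (alternating _ _ _ _ _ (inj₁ _) (inj₁ _) (inj₁ _) (inj₂ _) _ _ _ _ r₂) = ⊥-elim (old≢rung _ _ r₂)
  project (alternating _ _ _ _ _ (inj₁ _) _ (inj₂ _) _ _ _ _ r₁ _) = ⊥-elim (old≢rung _ _ r₁)
  project (alternating _ _ _ _ _ (inj₁ _) (inj₂ _) (inj₁ _) (inj₁ _) _ _ _ _ r₂) = ⊥-elim (old≢rung _ _ (≡.sym r₂))
  project (alternating _ _ _ _ _ (inj₁ _) (inj₂ (_ , refl)) (inj₁ (p₃ , refl)) (inj₂ (_ , refl)) _ _ _ _ r₂) =
    ⊥-elim (rungs-over-edge-differ p₃ r₂)
  project (alternating _ _ _ _ _ (inj₂ _) (inj₁ _) (inj₁ _) _ _ _ _ r₁ _) = ⊥-elim (old≢rung _ _ (≡.sym r₁))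
  project (alternating _ _ _ _ _ (inj₂ (_ , refl)) (inj₁ (p₂ , refl)) (inj₂ (_ , refl)) _ _ _ _ r₁ _) =
    ⊥-elim (rungs-over-edge-differ p₂ r₁)
  project (alternating _ _ _ _ _ (inj₂ (x≢y , refl)) (inj₂ (y≢z , refl)) _ _ t₁ _ _ _ _) =
    ⊥-elim (t₁ (two-rungs-return x≢y y≢z))

prism-star : ∀ {G k} → Symmetric G → Bipartite G →
  StarColourable G k → StarColourable (G □ P₂) (2 + k)
prism-star symmetric bipartite (c , star@(proper , _)) =
  prism-colouring , star-if-no-alternating-walk (□-symmetric symmetric ≢-sym) (prism-proper proper)
    (λ walk → star-has-no-alternating-walk bipartite star (project walk))
  where open Prism bipartite c

-- Flipping the i-th coordinate; direction zero is the last factor P₂.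
flip : ∀ {d} → Fin d → V (Q d) → V (Q d)
flip zero    (a , x) = a , not x
flip (suc i) (a , x) = flip i a , x

flip-adjacent : ∀ {d} (i : Fin d) u → Adj (Q d) u (flip i u)
flip-adjacent zero    (_ , _) = inj₂ (not-¬ refl , refl)
flip-adjacent (suc i) (a , _) = inj₁ (flip-adjacent i a , refl)

flip-involutive : ∀ {d} (i : Fin d) u → flip i (flip i u) ≡ u
flip-involutive zero    (a , x) = cong (a ,_) (not-involutive x)
flip-involutive (suc i) (a , x) = cong (_, x) (flip-involutive i a)

flip-injective : ∀ {d} {i j : Fin d} u → flip i u ≡ flip j u → i ≡ j
flip-injective {i = zero}  {zero}  _       _  = refl
flip-injective {i = zero}  {suc _} (_ , _) eq = contradiction (cong proj₂ eq) (≢-sym (not-¬ refl))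
flip-injective {i = suc _} {zero}  (_ , _) eq = contradiction (cong proj₂ eq) (not-¬ refl)
flip-injective {i = suc _} {suc _} (a , _) eq = cong suc (flip-injective a (cong proj₁ eq))

edge-direction : ∀ {d u v} → Adj (Q d) u v → Σ (Fin d) λ i → flip i u ≡ v
edge-direction {suc d} {a , x} (inj₁ (p , refl)) =
  let i , flip-i-a≡b = edge-direction p in suc i , cong (_, x) flip-i-a≡b
edge-direction {suc d} {a , x} (inj₂ (x≢y , refl)) = zero , cong (a ,_) (≡.sym (¬-not (≢-sym x≢y)))

all-bits? : {P : Bool → Set} → (∀ x → Dec (P x)) → Dec (∀ x → P x)
all-bits? P? = map′ (λ { (p₀ , p₁) false → p₀ ; (p₀ , p₁) true → p₁ })
                    (λ p → p false , p true) (P? false ×-dec P? true)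

all-vertices? : ∀ d {P : V (Q d) → Set} → (∀ v → Dec (P v)) → Dec (∀ v → P v)
all-vertices? zero    P? = map′ (λ p _ → p) (λ p → p tt) (P? tt)
all-vertices? (suc d) P? =
  map′ (λ p (a , x) → p a x) (λ p a x → p (a , x)) (all-vertices? d λ a → all-bits? λ x → P? (a , x))

-- A colour f i u for the edge from u in direction i, not changed by
-- crossing that edge, defines an edge colouring; properness and the absence
-- of alternating walks become finite conditions on f.
module DirectionColouring {d k : ℕ} (f : Fin d → V (Q d) → Fin k)
                          (f-flip : ∀ i u → f i (flip i u) ≡ f i u) where

  direction-col : (u v : V (Q d)) → Adj (Q d) u v → Fin k
  direction-col u _ p = f (proj₁ (edge-direction p)) u

  direction-col-sym : ∀ {u v} i j → flip i u ≡ v → flip j v ≡ u → f i u ≡ f j v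
  direction-col-sym {u} i j refl back
    with flip-injective u (trans (≡.sym (flip-involutive j (flip i u))) (cong (flip j) back))
  ... | refl = ≡.sym (f-flip i u)

  colouring : EdgeColouring (Q d) k
  colouring = record
    { col = direction-col
    ; sym = λ u v p q → direction-col-sym _ _ (proj₂ (edge-direction p)) (proj₂ (edge-direction q)) }

  DistinctAtVertices : Set
  DistinctAtVertices = ∀ u i j → i ≢ j → f i u ≢ f j u

  proper : DistinctAtVertices → Proper colouring
  proper distinct u v w p q v≢w =
    distinct u (proj₁ dp) (proj₁ dq)
      (λ i≡j → v≢w (trans (≡.sym (proj₂ dp)) (trans (cong (λ i → flip i u) i≡j) (proj₂ dq))))
    where
    dp : Σ (Fin d) λ i → flip i u ≡ v
    dp = edge-direction p
    dq : Σ (Fin d) λ i → flip i u ≡ w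
    dq = edge-direction q

  NoAlternation : Set
  NoAlternation = ∀ v₀ i₁ i₂ i₃ i₄ → i₁ ≢ i₂ → i₂ ≢ i₃ → i₃ ≢ i₄ →
    let v₁ = flip i₁ v₀ ; v₂ = flip i₂ v₁ ; v₃ = flip i₃ v₂ in
    f i₁ v₀ ≡ f i₃ v₂ → f i₂ v₁ ≢ f i₄ v₃

  no-alternating-walk : NoAlternation → ¬ AlternatingWalk colouring
  no-alternating-walk no-alternation (alternating v₀ v₁ v₂ v₃ v₄ e₁ e₂ e₃ e₄ t₁ t₂ t₃ r₁ r₂) =
    along-directions _ _ _ _ (proj₂ (edge-direction e₁)) (proj₂ (edge-direction e₂))
      (proj₂ (edge-direction e₃)) (proj₂ (edge-direction e₄)) t₁ t₂ t₃ r₁ r₂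
    where
    -- A turn back would be two flips in the same direction.
    no-turn : ∀ {i j} u → u ≢ flip j (flip i u) → i ≢ j
    no-turn {i} u u≢ refl = u≢ (≡.sym (flip-involutive i u))

    along-directions : ∀ {w₁ w₂ w₃ w₄} i₁ i₂ i₃ i₄ → flip i₁ v₀ ≡ w₁ → flip i₂ w₁ ≡ w₂ →
      flip i₃ w₂ ≡ w₃ → flip i₄ w₃ ≡ w₄ → v₀ ≢ w₂ → w₁ ≢ w₃ → w₂ ≢ w₄ →
      f i₁ v₀ ≡ f i₃ w₂ → f i₂ w₁ ≡ f i₄ w₃ → ⊥
    along-directions i₁ i₂ i₃ i₄ refl refl refl refl t₁ t₂ t₃ r₁ r₂ =
      no-alternation v₀ i₁ i₂ i₃ i₄ (no-turn _ t₁) (no-turn _ t₂) (no-turn _ t₃) r₁ r₂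

-- A star 4-edge-colouring of Q₃

-- The colour of an edge of Q₃ = ((⊤ × Bool) × Bool) × Bool depends on its
-- direction (0, 1, 2 flip the third, second, first coordinate) and on the
-- two coordinates the edge keeps fixed, in their order in the vertex.
colour-table : Fin 3 → Bool → Bool → Fin 4
colour-table zero             false false = # 2
colour-table zero             false true  = # 0
colour-table zero             true  false = # 3
colour-table zero             true  true  = # 1
colour-table (suc zero)       false false = # 1
colour-table (suc zero)       false true  = # 3
colour-table (suc zero)       true  false = # 2
colour-table (suc zero)       true  true  = # 0
colour-table (suc (suc zero)) false false = # 0
colour-table (suc (suc zero)) false true  = # 1
colour-table (suc (suc zero)) true  false = # 3
colour-table (suc (suc zero)) true  true  = # 2

colour₃ : Fin 3 → V (Q 3) → Fin 4
colour₃ zero             (((_ , x) , y) , _) = colour-table zero x y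
colour₃ (suc zero)       (((_ , x) , _) , z) = colour-table (suc zero) x z
colour₃ (suc (suc zero)) (((_ , _) , y) , z) = colour-table (suc (suc zero)) y z

colour₃-flip : ∀ i u → colour₃ i (flip i u) ≡ colour₃ i u
colour₃-flip zero             (((_ , _) , _) , _) = refl
colour₃-flip (suc zero)       (((_ , _) , _) , _) = refl
colour₃-flip (suc (suc zero)) (((_ , _) , _) , _) = refl

open DirectionColouring colour₃ colour₃-flip
  using (DistinctAtVertices; NoAlternation)
  renaming (colouring to colouring₃; proper to proper₃; no-alternating-walk to no-alternating-walk₃)

distinct-at-vertices₃ : DistinctAtVertices
distinct-at-vertices₃ = from-yes
  (all-vertices? 3 λ u → all? λ i → all? λ j → ¬? (i ≟ j) →-dec ¬? (colour₃ i u ≟ colour₃ j u))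

no-alternation₃ : NoAlternation
no-alternation₃ = from-yes
  (all-vertices? 3 λ v₀ → all? λ i₁ → all? λ i₂ → all? λ i₃ → all? λ i₄ →
    ¬? (i₁ ≟ i₂) →-dec ¬? (i₂ ≟ i₃) →-dec ¬? (i₃ ≟ i₄) →-dec
    let v₁ = flip i₁ v₀ ; v₂ = flip i₂ v₁ ; v₃ = flip i₃ v₂ in
    (colour₃ i₁ v₀ ≟ colour₃ i₃ v₂) →-dec ¬? (colour₃ i₂ v₁ ≟ colour₃ i₄ v₃))

star-Q₃ : StarColourable (Q 3) 4
star-Q₃ = colouring₃ ,
  star-if-no-alternating-walk (Q-symmetric 3) (proper₃ distinct-at-vertices₃) (no-alternating-walk₃ no-alternation₃)

-- Few colours: no star k-edge-colouring of Q_d when 2 ≤ d and k ≤ d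

-- An injection Fin n → Fin k with k ≤ n hits every element: otherwise
-- punching out the missed element gives an injection Fin n → Fin (k − 1).
injective⇒surjective : ∀ {n k} (f : Fin n → Fin k) → Injective _≡_ _≡_ f → k ≤ n →
  ∀ a → ∃ λ i → f i ≡ a
injective⇒surjective {n} {suc k} f injective k≤n a with any? (λ i → f i ≟ a)
... | yes hit  = hit
... | no  miss = contradiction (injective⇒≤ punched-injective) (<⇒≱ k≤n)
  where
  missed : ∀ i → a ≢ f i
  missed i a≡fi = miss (i , ≡.sym a≡fi)
  punched : Fin n → Fin k
  punched i = punchOut (missed i)
  punched-injective : Injective _≡_ _≡_ punched
  punched-injective {i} {j} eq = injective (punchOut-injective (missed i) (missed j) eq)

module Continuation {G : Graph} (symmetric : Symmetric G) {k : ℕ} (c : EdgeColouring G k)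
  (every-colour : ∀ u a → Σ (V G) λ w → Σ (Adj G u w) λ e → col c u w e ≡ a) where

  continue : ∀ {u v} (e : Adj G u v) {a} → a ≢ col c u v e →
    Σ (V G) λ w → Σ (Adj G v w) λ e′ → col c v w e′ ≡ a × u ≢ w
  continue {u} {v} e {a} a≢e =
    let w , e′ , e′≡a = every-colour v a in
    w , e′ , e′≡a ,
    different-colours⇒different-ends symmetric c (symmetric e) e′
      (λ eq → a≢e (trans (≡.sym e′≡a) (trans (≡.sym eq) (sym c _ _ (symmetric e) e))))

no-star-with-few-colours : ∀ d k → k ≤ suc (suc d) → ¬ StarColourable (Q (suc (suc d))) k
no-star-with-few-colours d k k≤ (c , star@(proper , _)) =
  star-has-no-alternating-walk (Q-bipartite D) star alternating-walk
  where
  D : ℕ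
  D = suc (suc d)

  origin : ∀ n → V (Q n)
  origin zero    = tt
  origin (suc n) = origin n , false

  -- The colours of the D edges at u are distinct, hence all k colours occur.
  neighbour-colour : ∀ u → Fin D → Fin k
  neighbour-colour u i = col c u (flip i u) (flip-adjacent i u)

  neighbour-colour-injective : ∀ u → Injective _≡_ _≡_ (neighbour-colour u)
  neighbour-colour-injective u {i} {j} eq with i ≟ j
  ... | yes i≡j = i≡j
  ... | no  i≢j = contradiction eq
        (proper u _ _ _ _ (λ flips≡ → i≢j (flip-injective u flips≡)))

  every-colour : ∀ u a → Σ (V (Q D)) λ w → Σ (Adj (Q D) u w) λ e → col c u w e ≡ a
  every-colour u a =
    let i , colour≡a = injective⇒surjective _ (neighbour-colour-injective u) k≤ a in
    flip i u , flip-adjacent i u , colour≡a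

  open Continuation (Q-symmetric D) c every-colour

  v₀ : V (Q D)
  v₀ = origin D

  e₁ : Adj (Q D) v₀ (flip {D} zero v₀)
  e₁ = flip-adjacent {D} zero v₀

  a b : Fin k
  a = neighbour-colour v₀ zero
  b = neighbour-colour v₀ (suc zero)

  a≢b : a ≢ b
  a≢b eq with neighbour-colour-injective v₀ eq
  ... | ()

  alternating-walk : AlternatingWalk c
  alternating-walk =
    let v₂ , e₂ , e₂≡b , t₁ = continue e₁ (≢-sym a≢b)
        v₃ , e₃ , e₃≡a , t₂ = continue e₂ (λ a≡e₂ → a≢b (trans a≡e₂ e₂≡b))
        v₄ , e₄ , e₄≡b , t₃ = continue e₃ (λ b≡e₃ → a≢b (≡.sym (trans b≡e₃ e₃≡a)))
    in alternating _ _ v₂ v₃ v₄ e₁ e₂ e₃ e₄ t₁ t₂ t₃ (≡.sym e₃≡a) (trans e₂≡b (≡.sym e₄≡b))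

upper-bound-from-Q₃ : ∀ n → StarColourable (Q (3 + n)) (4 + 2 * n)
upper-bound-from-Q₃ zero    = star-Q₃
upper-bound-from-Q₃ (suc n) =
  subst (StarColourable (Q (4 + n))) (≡.sym (cong (4 +_) (*-suc 2 n)))
    (prism-star (Q-symmetric (3 + n)) (Q-bipartite (3 + n)) (upper-bound-from-Q₃ n))

-- Reindexing, using 2 · (3 + n) ∸ 2 = 4 + 2 · n.
upper-bound : (d : ℕ) → 3 ≤ d → StarColourable (Q d) (2 * d ∸ 2)
upper-bound (suc (suc (suc n))) _ =
  subst (StarColourable (Q (3 + n))) (≡.sym (cong (_∸ 2) (*-distribˡ-+ 2 3 n))) (upper-bound-from-Q₃ n)
upper-bound (suc zero)       (s≤s ())
upper-bound (suc (suc zero)) (s≤s (s≤s ()))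

corollary4 : ((d : ℕ) → 3 ≤ d → StarColourable (Q d) (2 * d ∸ 2))
    × ∃ (λ d → 3 ≤ d × StarColourable (Q d) (2 * d ∸ 2)
                     × ((k : ℕ) → k < 2 * d ∸ 2 → ¬ StarColourable (Q d) k))
corollary4 =
  upper-bound ,
  (3 , s≤s (s≤s (s≤s z≤n)) , star-Q₃ , λ k k<4 → no-star-with-few-colours 1 k (≤-pred k<4))
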